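{- Let $G$ be a cycle on $n_2\geq 3$ vertices. Then the graph $G^{\dagger}$ obtained from $G$ by the leaf-connecting-operation is neutral.
   Context: The leaf-connecting-operation applied to a graph $G$: (1) for each vertex $v$ of $G$, attach $d_v$ new vertices of degree one (leaves) adjacent to $v$, where $d_v$ is the degree of $v$ in $G$; (2) then repeatedly join a pair of (remaining) leaves by an edge, until no leaf is left. The resulting graph is $G^{\dagger}$ (any such pairing). For a simple connected graph $G=(V,E)$ with $m\geq1$ edges, where $e_{uv}$ denotes the edge with endpoints $u,v$, the assortativity coefficient is $$r=\frac{m^{ -1}\sum_{e_{uv}\in E} d_{u}d_{v}-\Big[m^{ -1}\sum_{e_{uv}\in E} \tfrac{1}{2}(d_{u}+d_{v})\Big]^{2}}{m^{ -1}\sum_{e_{uv}\in E} \tfrac{1}{2}(d^{2}_{u}+d^{2}_{v})-\Big[m^{ -1}\sum_{e_{uv}\in E} \tfrac{1}{2}(d_{u}+d_{v})\Big]^{2}},$$ and $G$ is called neutral if $r$ is well defined (nonzero denominator) and $r=0$. -}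

module Defs where

open import Data.Nat using (ℕ; zero; suc; _+_; _*_; _≤_)
open import Data.Nat.Properties using (_≟_)
open import Data.Fin using (Fin; zero; suc; inject₁; fromℕ; _↑ˡ_; _↑ʳ_)
open import Data.Fin.Properties as FinP using ()
open import Data.List using (List; []; _∷_; _++_; map; length; filter; allFin; concatMap; lookup)
open import Data.Nat.ListAction using (sum)
open import Data.List.Relation.Binary.Permutation.Propositional using (_↭_)
open import Data.Product using (_×_; _,_; proj₁; proj₂; Σ)
open import Data.Integer using (+_)
open import Data.Rational using (ℚ; 0ℚ; _-_; _÷_; ≢-nonZero)
import Data.Rational as ℚ
open import Relation.Nullary.Decidable using (_⊎-dec_)
open import Relation.Binary.PropositionalEquality using (_≡_; _≢_)

EdgeList : ℕ → Set
EdgeList N = List (Fin N × Fin N)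

deg : ∀ {N} → EdgeList N → Fin N → ℕ
deg E v = length (filter (λ e → (v FinP.≟ proj₁ e) ⊎-dec (v FinP.≟ proj₂ e)) E)

-- s / m as a rational (m ≥ 1 in all uses; value at m = 0 is irrelevant)
_/ₙ_ : ℕ → ℕ → ℚ
s /ₙ zero = 0ℚ
s /ₙ suc k = (+ s) ℚ./ suc k

meanProd : ∀ {N} → EdgeList N → ℚ
meanProd E = sum (map (λ e → deg E (proj₁ e) * deg E (proj₂ e)) E) /ₙ length E

meanHalfSum : ∀ {N} → EdgeList N → ℚ
meanHalfSum E = sum (map (λ e → deg E (proj₁ e) + deg E (proj₂ e)) E) /ₙ (2 * length E)

meanHalfSq : ∀ {N} → EdgeList N → ℚ
meanHalfSq E =
  sum (map (λ e → deg E (proj₁ e) * deg E (proj₁ e) + deg E (proj₂ e) * deg E (proj₂ e)) E)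
    /ₙ (2 * length E)

assortNum : ∀ {N} → EdgeList N → ℚ
assortNum E = meanProd E - meanHalfSum E ℚ.* meanHalfSum E

assortDen : ∀ {N} → EdgeList N → ℚ
assortDen E = meanHalfSq E - meanHalfSum E ℚ.* meanHalfSum E

assortativity : ∀ {N} (E : EdgeList N) → assortDen E ≢ 0ℚ → ℚ
assortativity E h = _÷_ (assortNum E) (assortDen E) {{≢-nonZero h}}

Neutral : ∀ {N} → EdgeList N → Set
Neutral E = (1 ≤ length E) × Σ (assortDen E ≢ 0ℚ) (λ h → assortativity E h ≡ 0ℚ)

cycleEdges : (n : ℕ) → EdgeList n
cycleEdges zero = []
cycleEdges (suc k) = map (λ i → (inject₁ i , suc i)) (allFin k) ++ ((fromℕ k , zero) ∷ [])

-- Step (1): each edge (u , v) contributes one leaf at u and one at v, so vertex v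
-- receives exactly d_v leaves.  The leaves are indexed by Fin (length (leafOwners E)),
-- the leaf ℓ being attached to the vertex  lookup (leafOwners E) ℓ.
leafOwners : ∀ {N} → EdgeList N → List (Fin N)
leafOwners E = concatMap (λ e → proj₁ e ∷ proj₂ e ∷ []) E

Leaf : ∀ {N} → EdgeList N → Set
Leaf E = Fin (length (leafOwners E))

-- Step (2): a pairing of the leaves is a list of pairs in which every leaf occurs
-- exactly once (i.e. the flattened list is a permutation of all leaves).
IsPairing : ∀ {N} (E : EdgeList N) → List (Leaf E × Leaf E) → Set
IsPairing E P = concatMap (λ p → proj₁ p ∷ proj₂ p ∷ []) P ↭ allFin (length (leafOwners E))

dagger : ∀ {N} (E : EdgeList N) → List (Leaf E × Leaf E) → EdgeList (N + length (leafOwners E))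
dagger {N} E P =
  map (λ e → (orig (proj₁ e) , orig (proj₂ e))) E
  ++ map (λ ℓ → (orig (lookup (leafOwners E) ℓ) , leaf ℓ)) (allFin L)
  ++ map (λ p → (leaf (proj₁ p) , leaf (proj₂ p))) P
  where
    L = length (leafOwners E)
    orig : Fin N → Fin (N + L)
    orig v = v ↑ˡ L
    leaf : Fin L → Fin (N + L)
    leaf ℓ = N ↑ʳ ℓ

-- In G† a vertex of a k-regular loopless graph G keeps its k edges and gains k leaves, so it has
-- degree 2k, while every leaf is joined to its owner and to its partner and has degree 2.  If G
-- has a edges then G† has a edges of type (2k, 2k), 2a of type (2k, 2) and a of type (2, 2), so
-- the three edge means in r are k + 1, (k + 1)² and 2(k² + 1) = (k + 1)² + (k − 1)²: the
-- numerator of r vanishes and its denominator is (k − 1)² ≠ 0 once k ≥ 2.  A cycle is 2-regular.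
module Submission where

open import Level using (Level)
open import Function using (_∘_; id)
open import Data.Bool using (true; false)
open import Data.Empty using (⊥-elim)
open import Data.Product using (_×_; _,_; proj₁; proj₂)
open import Data.Sum as Sum using (_⊎_; inj₁; inj₂; [_,_])
open import Relation.Nullary using (yes; no; does)
open import Relation.Nullary.Decidable using (_⊎-dec_)
open import Relation.Unary using (Pred; Decidable; _≐_)
open import Relation.Binary.PropositionalEquality
  using (_≡_; _≢_; refl; sym; trans; cong; cong₂; subst; setoid; module ≡-Reasoning)

open import Data.Nat using (ℕ; zero; suc; _+_; _*_; _≤_; s≤s; z≤n)
open import Data.Nat.Properties using (m+1+n≢m; <⇒≤; +-identityʳ; *-suc; *-cancelˡ-≡; ≤-trans; m≤n*m; ≤-refl)
open import Data.Nat.Coprimality as Coprimality using (1-coprimeTo)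
open import Data.Nat.ListAction using (sum)
open import Data.Nat.ListAction.Properties using (sum-++)
open import Data.Nat.Tactic.RingSolver using (solve-∀)
import Data.Integer as ℤ
import Data.Integer.Properties as ℤP
open import Data.Rational as ℚ using (ℚ; 0ℚ; mkℚ; _/_; _÷_; ↥_; NonZero)
import Data.Rational.Properties as ℚP
open import Data.Rational.Unnormalised using (mkℚᵘ; *≡*)
open import Algebra.Properties.Group ℚP.+-0-group using (x∙y⁻¹≈ε⇒x≈y; x≈y⇒x∙y⁻¹≈ε)

open import Data.Fin using (Fin; zero; suc; inject₁; fromℕ; _↑ˡ_; _↑ʳ_; splitAt)
open import Data.Fin.Properties using (_≟_; suc-injective; ↑ˡ-injective; ↑ʳ-injective; splitAt-↑ˡ; splitAt-↑ʳ)
open import Data.List using (List; []; _∷_; _++_; _∷ʳ_; map; length; filter; allFin; lookup; tabulate)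
import Data.List.Properties as List
open import Data.List.Membership.Propositional using (_∈_)
open import Data.List.Membership.Propositional.Properties using (∈-allFin)
open import Data.List.Relation.Unary.All as All using (All; []; _∷_)
import Data.List.Relation.Unary.All.Properties as All
open import Data.List.Relation.Unary.Any using (here; there)
open import Data.List.Relation.Unary.Unique.Propositional using (Unique; []; _∷_)
open import Data.List.Relation.Unary.Unique.Propositional.Properties using (allFin⁺)
open import Data.List.Relation.Binary.Permutation.Propositional
  using (_↭_; prep; ↭-refl; ↭-sym; ↭-trans; ↭-reflexive; ↭⇒↭ₛ)
open import Data.List.Relation.Binary.Permutation.Propositional.Properties using (↭-length; filter-↭; shift; ∷↭∷ʳ)
import Data.List.Relation.Binary.Permutation.Setoid.Properties as Permutationₛ

open import Defs

open ≡-Reasoning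

private variable
  a b p q : Level
  A : Set a
  B : Set b
  N : ℕ

÷-zeroˡ : {p : ℚ} (q : ℚ) .{{_ : NonZero q}} → p ≡ 0ℚ → p ÷ q ≡ 0ℚ
÷-zeroˡ q refl = ℚP.*-zeroˡ (ℚ.1/ q)

neutral-from-means : (E : EdgeList N) → 1 ≤ length E →
                     meanProd E ≡ meanHalfSum E ℚ.* meanHalfSum E →
                     meanHalfSq E ≢ meanHalfSum E ℚ.* meanHalfSum E →
                     Neutral E
neutral-from-means E m≥1 prod≡sq sq≢sq =
  m≥1 , den≢0 , ÷-zeroˡ (assortDen E) {{ℚ.≢-nonZero den≢0}} (x≈y⇒x∙y⁻¹≈ε prod≡sq)
  where
  den≢0 : assortDen E ≢ 0ℚ
  den≢0 den≡0 = sq≢sq (x∙y⁻¹≈ε⇒x≈y _ _ den≡0)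

_/1 : ℕ → ℚ
n /1 = ℤ.+ n / 1

/1≡mkℚ : ∀ n → n /1 ≡ mkℚ (ℤ.+ n) 0 (Coprimality.sym (1-coprimeTo n))
/1≡mkℚ n = ℚP.fromℚᵘ-toℚᵘ (mkℚ (ℤ.+ n) 0 (Coprimality.sym (1-coprimeTo n)))

/1-injective : ∀ {m n} → m /1 ≡ n /1 → m ≡ n
/1-injective {m} {n} eq = ℤP.+-injective (cong ↥_ (trans (sym (/1≡mkℚ m)) (trans eq (/1≡mkℚ n))))

/1-homo-* : ∀ m n → (m * n) /1 ≡ m /1 ℚ.* n /1
/1-homo-* m n = begin
  (m * n) /1             ≡⟨ cong (_/ 1) (ℤP.pos-* m n) ⟩
  (ℤ.+ m ℤ.* ℤ.+ n) / 1  ≡⟨ cong₂ ℚ._*_ (/1≡mkℚ m) (/1≡mkℚ n) ⟨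
  m /1 ℚ.* n /1          ∎

/ₙ-exact : ∀ {s} q m → 1 ≤ m → s ≡ q * m → s /ₙ m ≡ q /1
-- Both sides are fromℚᵘ of unnormalised fractions, which agree when their cross products do.
/ₙ-exact q (suc m) _ refl = ℚP.fromℚᵘ-cong {mkℚᵘ (ℤ.+ (q * suc m)) m} {mkℚᵘ (ℤ.+ q) 0} (*≡* (begin
  ℤ.+ (q * suc m) ℤ.* ℤ.+ 1  ≡⟨ ℤP.*-identityʳ _ ⟩
  ℤ.+ (q * suc m)            ≡⟨ ℤP.pos-* q (suc m) ⟩
  ℤ.+ q ℤ.* ℤ.+ suc m        ∎))

length-filter-map : {P : Pred B p} (P? : Decidable P) (f : A → B) (xs : List A) →
                    length (filter P? (map f xs)) ≡ length (filter (P? ∘ f) xs)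
length-filter-map P? f [] = refl
length-filter-map P? f (x ∷ xs) with does (P? (f x))
... | true  = cong suc (length-filter-map P? f xs)
... | false = length-filter-map P? f xs

length-filter-≐ : {P : Pred A p} {Q : Pred A q} (P? : Decidable P) (Q? : Decidable Q) →
                  P ≐ Q → (xs : List A) → length (filter P? xs) ≡ length (filter Q? xs)
length-filter-≐ P? Q? P≐Q xs = cong length (List.filter-≐ P? Q? P≐Q xs)

sum-map-const : (f : A → ℕ) {c : ℕ} → (∀ x → f x ≡ c) → (xs : List A) →
                sum (map f xs) ≡ length xs * c
sum-map-const f f≡c []       = refl
sum-map-const f f≡c (x ∷ xs) = cong₂ _+_ (f≡c x) (sum-map-const f f≡c xs)

sum-map-++ : (f : A → ℕ) (xs ys : List A) →
             sum (map f (xs ++ ys)) ≡ sum (map f xs) + sum (map f ys)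
sum-map-++ f xs ys = trans (cong sum (List.map-++ f xs ys)) (sum-++ (map f xs) (map f ys))

tabulate-∷ʳ : ∀ {n} (f : Fin (suc n) → A) → tabulate f ≡ tabulate (f ∘ inject₁) ∷ʳ f (fromℕ n)
tabulate-∷ʳ {n = zero}  f = refl
tabulate-∷ʳ {n = suc n} f = cong (f zero ∷_) (tabulate-∷ʳ (f ∘ suc))

occurrences : Fin N → List (Fin N) → ℕ
occurrences v xs = length (filter (v ≟_) xs)

occurrences-↭ : ∀ (v : Fin N) {xs ys} → xs ↭ ys → occurrences v xs ≡ occurrences v ys
occurrences-↭ v xs↭ys = ↭-length (filter-↭ (v ≟_) xs↭ys)

occurrences-++ : ∀ (v : Fin N) xs ys → occurrences v (xs ++ ys) ≡ occurrences v xs + occurrences v ys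
occurrences-++ v xs ys =
  trans (cong length (List.filter-++ (v ≟_) xs ys)) (List.length-++ (filter (v ≟_) xs))

occurrences-unique : ∀ {v : Fin N} {xs} → Unique xs → v ∈ xs → occurrences v xs ≡ 1
occurrences-unique {v = v} {v ∷ xs} (v∉xs ∷ _) (here refl) = begin
  length (filter (v ≟_) (v ∷ xs))   ≡⟨ cong length (List.filter-accept (v ≟_) refl) ⟩
  suc (length (filter (v ≟_) xs))   ≡⟨ cong (suc ∘ length) (List.filter-none (v ≟_) v∉xs) ⟩
  1                                 ∎
occurrences-unique {v = v} {x ∷ xs} (x∉xs ∷ unique) (there v∈xs) = begin
  length (filter (v ≟_) (x ∷ xs))   ≡⟨ cong length (List.filter-reject (v ≟_) (All.lookup x∉xs v∈xs ∘ sym)) ⟩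
  length (filter (v ≟_) xs)         ≡⟨ occurrences-unique unique v∈xs ⟩
  1                                 ∎

occurrences-allFin : ∀ {n} (v : Fin n) → occurrences v (allFin n) ≡ 1
occurrences-allFin {n} v = occurrences-unique (allFin⁺ n) (∈-allFin v)

Loopless : EdgeList N → Set
Loopless E = All (λ e → proj₁ e ≢ proj₂ e) E

incident? : (v : Fin N) → Decidable (λ (e : Fin N × Fin N) → v ≡ proj₁ e ⊎ v ≡ proj₂ e)
incident? v e = (v ≟ proj₁ e) ⊎-dec (v ≟ proj₂ e)

-- deg counts a loop at v once, while leafOwners lists v twice for it.
deg≡occurrences : {E : EdgeList N} → Loopless E → ∀ v → deg E v ≡ occurrences v (leafOwners E)
deg≡occurrences [] v = refl
deg≡occurrences {E = (a , b) ∷ E} (a≢b ∷ loopless) v with v ≟ a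
... | yes refl with v ≟ b
...   | yes refl = ⊥-elim (a≢b refl)
...   | no _     = cong suc (deg≡occurrences loopless v)
deg≡occurrences {E = (a , b) ∷ E} (a≢b ∷ loopless) v | no _ with v ≟ b
...   | yes _ = cong suc (deg≡occurrences loopless v)
...   | no _  = deg≡occurrences loopless v

unique-leafOwners⇒loopless : (E : EdgeList N) → Unique (leafOwners E) → Loopless E
unique-leafOwners⇒loopless []      _                          = []
unique-leafOwners⇒loopless (_ ∷ E) ((a≢b ∷ _) ∷ (_ ∷ unique)) = a≢b ∷ unique-leafOwners⇒loopless E unique

leafOwners-↭ : (E : EdgeList N) → leafOwners E ↭ map proj₁ E ++ map proj₂ E
leafOwners-↭ []            = ↭-refl
leafOwners-↭ ((a , b) ∷ E) =
  prep a (↭-trans (prep b (leafOwners-↭ E)) (↭-sym (shift b (map proj₁ E) (map proj₂ E))))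

occurrences-leafOwners : (E : EdgeList N) (v : Fin N) →
                         occurrences v (leafOwners E) ≡ occurrences v (map proj₁ E) + occurrences v (map proj₂ E)
occurrences-leafOwners E v = trans (occurrences-↭ v (leafOwners-↭ E)) (occurrences-++ v (map proj₁ E) _)

length-leafOwners : (E : EdgeList N) → length (leafOwners E) ≡ 2 * length E
length-leafOwners []      = refl
length-leafOwners (_ ∷ E) = trans (cong (2 +_) (length-leafOwners E)) (sym (*-suc 2 (length E)))

deg-++ : (E F : EdgeList N) (v : Fin N) → deg (E ++ F) v ≡ deg E v + deg F v
deg-++ E F v =
  trans (cong length (List.filter-++ (incident? v) E F)) (List.length-++ (filter (incident? v) E))

deg-map-injective : ∀ {M} (f : Fin N → Fin M) → (∀ {u w} → f u ≡ f w → u ≡ w) →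
                    (E : EdgeList N) (v : Fin N) →
                    deg (map (λ e → f (proj₁ e) , f (proj₂ e)) E) (f v) ≡ deg E v
deg-map-injective f f-injective E v = trans (length-filter-map (incident? (f v)) _ E)
  (length-filter-≐ _ (incident? v) (Sum.map f-injective f-injective , Sum.map (cong f) (cong f)) E)

module _ (E : EdgeList N) where

  private
    L : ℕ
    L = length (leafOwners E)

  orig : Fin N → Fin (N + L)
  orig v = v ↑ˡ L

  leaf : Leaf E → Fin (N + L)
  leaf ℓ = N ↑ʳ ℓ

  orig≢leaf : ∀ {v ℓ} → orig v ≢ leaf ℓ
  orig≢leaf {v} {ℓ} eq
    with () ← trans (sym (splitAt-↑ˡ N v L)) (trans (cong (splitAt N) eq) (splitAt-↑ʳ N L ℓ))

  originalEdges : EdgeList (N + L)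
  originalEdges = map (λ e → orig (proj₁ e) , orig (proj₂ e)) E

  pendantEdges : EdgeList (N + L)
  pendantEdges = map (λ ℓ → orig (lookup (leafOwners E) ℓ) , leaf ℓ) (allFin L)

  pairingEdges : List (Leaf E × Leaf E) → EdgeList (N + L)
  pairingEdges P = map (λ p → leaf (proj₁ p) , leaf (proj₂ p)) P

  length-originalEdges : length originalEdges ≡ length E
  length-originalEdges = List.length-map _ E

  length-pendantEdges : length pendantEdges ≡ 2 * length E
  length-pendantEdges = begin
    length pendantEdges  ≡⟨ List.length-map _ (allFin L) ⟩
    length (allFin L)    ≡⟨ List.length-tabulate id ⟩
    L                    ≡⟨ length-leafOwners E ⟩
    2 * length E         ∎

  length-pairingEdges : ∀ P → length (pairingEdges P) ≡ length P
  length-pairingEdges P = List.length-map _ P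

  deg-dagger : ∀ P x → deg (dagger E P) x ≡ deg originalEdges x + (deg pendantEdges x + deg (pairingEdges P) x)
  deg-dagger P x =
    trans (deg-++ originalEdges _ x) (cong (deg originalEdges x +_) (deg-++ pendantEdges _ x))

  deg-originalEdges-orig : ∀ v → deg originalEdges (orig v) ≡ deg E v
  deg-originalEdges-orig = deg-map-injective orig (↑ˡ-injective L _ _) E

  deg-originalEdges-leaf : ∀ ℓ → deg originalEdges (leaf ℓ) ≡ 0
  deg-originalEdges-leaf ℓ = trans (length-filter-map (incident? (leaf ℓ)) _ E)
    (cong length (List.filter-none _ (All.universal (λ _ → [ orig≢leaf ∘ sym , orig≢leaf ∘ sym ]) E)))

  deg-pendantEdges-orig : ∀ v → deg pendantEdges (orig v) ≡ occurrences v (leafOwners E)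
  deg-pendantEdges-orig v = begin
    deg pendantEdges (orig v)
      ≡⟨ length-filter-map (incident? (orig v)) _ (allFin L) ⟩
    length (filter (λ ℓ → incident? (orig v) (orig (owner ℓ) , leaf ℓ)) (allFin L))
      ≡⟨ length-filter-≐ _ ((v ≟_) ∘ owner)
           ([ ↑ˡ-injective L _ _ , ⊥-elim ∘ orig≢leaf ] , inj₁ ∘ cong orig) (allFin L) ⟩
    length (filter ((v ≟_) ∘ owner) (allFin L))
      ≡⟨ length-filter-map (v ≟_) owner (allFin L) ⟨
    occurrences v (map owner (allFin L))
      ≡⟨ cong (occurrences v) (trans (List.map-tabulate id owner) (List.tabulate-lookup (leafOwners E))) ⟩
    occurrences v (leafOwners E)
      ∎
    where
    owner : Leaf E → Fin N
    owner = lookup (leafOwners E)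

  deg-pendantEdges-leaf : ∀ ℓ → deg pendantEdges (leaf ℓ) ≡ 1
  deg-pendantEdges-leaf ℓ = begin
    deg pendantEdges (leaf ℓ)
      ≡⟨ length-filter-map (incident? (leaf ℓ)) _ (allFin L) ⟩
    length (filter (λ ℓ′ → incident? (leaf ℓ) (orig (lookup (leafOwners E) ℓ′) , leaf ℓ′)) (allFin L))
      ≡⟨ length-filter-≐ _ (ℓ ≟_)
           ([ ⊥-elim ∘ orig≢leaf ∘ sym , ↑ʳ-injective N _ _ ] , inj₂ ∘ cong leaf) (allFin L) ⟩
    occurrences ℓ (allFin L)
      ≡⟨ occurrences-allFin ℓ ⟩
    1 ∎

  deg-pairingEdges-orig : ∀ P v → deg (pairingEdges P) (orig v) ≡ 0
  deg-pairingEdges-orig P v = trans (length-filter-map (incident? (orig v)) _ P)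
    (cong length (List.filter-none _ (All.universal (λ _ → [ orig≢leaf , orig≢leaf ]) P)))

  deg-pairingEdges-leaf : ∀ P ℓ → deg (pairingEdges P) (leaf ℓ) ≡ deg P ℓ
  deg-pairingEdges-leaf = deg-map-injective leaf (↑ʳ-injective N _ _)

  deg-dagger-orig : ∀ P v → deg (dagger E P) (orig v) ≡ deg E v + occurrences v (leafOwners E)
  deg-dagger-orig P v = begin
    deg (dagger E P) (orig v)
      ≡⟨ deg-dagger P (orig v) ⟩
    deg originalEdges (orig v) + (deg pendantEdges (orig v) + deg (pairingEdges P) (orig v))
      ≡⟨ cong₂ _+_ (deg-originalEdges-orig v)
                   (cong₂ _+_ (deg-pendantEdges-orig v) (deg-pairingEdges-orig P v)) ⟩
    deg E v + (occurrences v (leafOwners E) + 0)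
      ≡⟨ cong (deg E v +_) (+-identityʳ _) ⟩
    deg E v + occurrences v (leafOwners E)
      ∎

  deg-dagger-leaf : ∀ P ℓ → deg (dagger E P) (leaf ℓ) ≡ 1 + deg P ℓ
  deg-dagger-leaf P ℓ = begin
    deg (dagger E P) (leaf ℓ)
      ≡⟨ deg-dagger P (leaf ℓ) ⟩
    deg originalEdges (leaf ℓ) + (deg pendantEdges (leaf ℓ) + deg (pairingEdges P) (leaf ℓ))
      ≡⟨ cong₂ _+_ (deg-originalEdges-leaf ℓ)
                   (cong₂ _+_ (deg-pendantEdges-leaf ℓ) (deg-pairingEdges-leaf P ℓ)) ⟩
    1 + deg P ℓ
      ∎

module _ (E : EdgeList N) (P : List (Leaf E × Leaf E)) (pairing : IsPairing E P) where

  deg-pairing : ∀ ℓ → deg P ℓ ≡ 1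
  deg-pairing ℓ = begin
    deg P ℓ                       ≡⟨ deg≡occurrences (unique-leafOwners⇒loopless P unique) ℓ ⟩
    occurrences ℓ (leafOwners P)  ≡⟨ occurrences-↭ ℓ pairing ⟩
    occurrences ℓ (allFin _)      ≡⟨ occurrences-allFin ℓ ⟩
    1                             ∎
    where
    unique : Unique (leafOwners P)
    unique = Permutationₛ.Unique-resp-↭ (setoid _) (↭⇒↭ₛ (↭-sym pairing)) (allFin⁺ _)

  length-pairing : length P ≡ length E
  length-pairing = *-cancelˡ-≡ _ _ 2 (begin
    2 * length P                  ≡⟨ length-leafOwners P ⟨
    length (leafOwners P)         ≡⟨ ↭-length pairing ⟩
    length (allFin (length (leafOwners E)))
                                  ≡⟨ List.length-tabulate id ⟩
    length (leafOwners E)         ≡⟨ length-leafOwners E ⟩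
    2 * length E                  ∎)

  deg-dagger-leaf-pairing : ∀ ℓ → deg (dagger E P) (leaf E ℓ) ≡ 2
  deg-dagger-leaf-pairing ℓ = trans (deg-dagger-leaf E P ℓ) (cong suc (deg-pairing ℓ))

  length-dagger : length (dagger E P) ≡ 4 * length E
  length-dagger = begin
    length (dagger E P)
      ≡⟨ List.length-++ (originalEdges E) ⟩
    length (originalEdges E) + length (pendantEdges E ++ pairingEdges E P)
      ≡⟨ cong (length (originalEdges E) +_) (List.length-++ (pendantEdges E)) ⟩
    length (originalEdges E) + (length (pendantEdges E) + length (pairingEdges E P))
      ≡⟨ cong₂ _+_ (length-originalEdges E)
                   (cong₂ _+_ (length-pendantEdges E) (trans (length-pairingEdges E P) length-pairing)) ⟩
    length E + (2 * length E + length E)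
      ≡⟨ four (length E) ⟩
    4 * length E
      ∎
    where
    four : ∀ a → a + (2 * a + a) ≡ 4 * a
    four = solve-∀

  length-dagger-positive : 1 ≤ length E → 1 ≤ length (dagger E P)
  length-dagger-positive m≥1 = subst (1 ≤_) (sym length-dagger) (≤-trans m≥1 (m≤n*m (length E) 4))

  double-length-dagger-positive : 1 ≤ length E → 1 ≤ 2 * length (dagger E P)
  double-length-dagger-positive m≥1 = ≤-trans (length-dagger-positive m≥1) (m≤n*m _ 2)

2[k²+1]≢[1+k]² : ∀ {k} → 2 ≤ k → 2 * (k * k + 1) ≢ suc k * suc k
2[k²+1]≢[1+k]² {suc (suc j)} (s≤s (s≤s z≤n)) eq = m+1+n≢m _ (trans (sym (gap j)) eq)
  where
  gap : ∀ j → 2 * ((2 + j) * (2 + j) + 1) ≡ (3 + j) * (3 + j) + suc j * suc j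
  gap = solve-∀

module _ (E : EdgeList N) (P : List (Leaf E × Leaf E)) {k : ℕ}
         (loopless : Loopless E) (regular : ∀ v → deg E v ≡ k) (pairing : IsPairing E P) where

  private
    L : ℕ
    L = length (leafOwners E)
    E† : EdgeList (N + L)
    E† = dagger E P

  deg-dagger-orig-regular : ∀ v → deg E† (orig E v) ≡ k + k
  deg-dagger-orig-regular v = begin
    deg E† (orig E v)                       ≡⟨ deg-dagger-orig E P v ⟩
    deg E v + occurrences v (leafOwners E)  ≡⟨ cong (deg E v +_) (deg≡occurrences loopless v) ⟨
    deg E v + deg E v                       ≡⟨ cong₂ _+_ (regular v) (regular v) ⟩
    k + k                                   ∎

  sum-dagger-degrees : (φ : ℕ → ℕ → ℕ) →
    sum (map (λ e → φ (deg E† (proj₁ e)) (deg E† (proj₂ e))) E†) ≡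
    length E * (φ (k + k) (k + k) + 2 * φ (k + k) 2 + φ 2 2)
  sum-dagger-degrees φ = begin
    sum (map F E†)
      ≡⟨ sum-map-++ F (originalEdges E) _ ⟩
    sum (map F (originalEdges E)) + sum (map F (pendantEdges E ++ pairingEdges E P))
      ≡⟨ cong (sum (map F (originalEdges E)) +_) (sum-map-++ F (pendantEdges E) (pairingEdges E P)) ⟩
    sum (map F (originalEdges E)) + (sum (map F (pendantEdges E)) + sum (map F (pairingEdges E P)))
      ≡⟨ cong₂ _+_ sum-original (cong₂ _+_ sum-pendant sum-pairing) ⟩
    length E * φ (k + k) (k + k) + (2 * length E * φ (k + k) 2 + length E * φ 2 2)
      ≡⟨ collect (length E) _ _ _ ⟩
    length E * (φ (k + k) (k + k) + 2 * φ (k + k) 2 + φ 2 2)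
      ∎
    where
    F : Fin (N + L) × Fin (N + L) → ℕ
    F e = φ (deg E† (proj₁ e)) (deg E† (proj₂ e))

    sum-block : ∀ {X : Set} {g : X → Fin (N + L) × Fin (N + L)} {c} (xs : List X) →
                (∀ x → F (g x) ≡ c) → sum (map F (map g xs)) ≡ length xs * c
    sum-block {g = g} xs F∘g≡c = trans (cong sum (sym (List.map-∘ xs))) (sum-map-const (F ∘ g) F∘g≡c xs)

    deg-leaf : ∀ ℓ → deg E† (leaf E ℓ) ≡ 2
    deg-leaf = deg-dagger-leaf-pairing E P pairing

    sum-original : sum (map F (originalEdges E)) ≡ length E * φ (k + k) (k + k)
    sum-original = sum-block E (λ e → cong₂ φ (deg-dagger-orig-regular (proj₁ e)) (deg-dagger-orig-regular (proj₂ e)))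

    sum-pendant : sum (map F (pendantEdges E)) ≡ 2 * length E * φ (k + k) 2
    sum-pendant = trans (sum-block (allFin L) (λ ℓ → cong₂ φ (deg-dagger-orig-regular _) (deg-leaf ℓ)))
                        (cong (_* φ (k + k) 2) (trans (List.length-tabulate id) (length-leafOwners E)))

    sum-pairing : sum (map F (pairingEdges E P)) ≡ length E * φ 2 2
    sum-pairing = trans (sum-block P (λ p → cong₂ φ (deg-leaf (proj₁ p)) (deg-leaf (proj₂ p))))
                        (cong (_* φ 2 2) (length-pairing E P pairing))

    collect : ∀ a x y z → a * x + (2 * a * y + a * z) ≡ a * (x + 2 * y + z)
    collect = solve-∀

  meanHalfSum-dagger : 1 ≤ length E → meanHalfSum E† ≡ suc k /1
  meanHalfSum-dagger m≥1 =
    /ₙ-exact (suc k) (2 * length E†) (double-length-dagger-positive E P pairing m≥1) (begin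
      sum (map (λ e → deg E† (proj₁ e) + deg E† (proj₂ e)) E†)
        ≡⟨ sum-dagger-degrees _+_ ⟩
      length E * ((k + k) + (k + k) + 2 * ((k + k) + 2) + (2 + 2))
        ≡⟨ arith (length E) k ⟩
      suc k * (2 * (4 * length E))
        ≡⟨ cong (λ m → suc k * (2 * m)) (length-dagger E P pairing) ⟨
      suc k * (2 * length E†)
        ∎)
    where
    arith : ∀ a k → a * ((k + k) + (k + k) + 2 * ((k + k) + 2) + (2 + 2)) ≡ suc k * (2 * (4 * a))
    arith = solve-∀

  meanProd-dagger : 1 ≤ length E → meanProd E† ≡ (suc k * suc k) /1
  meanProd-dagger m≥1 =
    /ₙ-exact (suc k * suc k) (length E†) (length-dagger-positive E P pairing m≥1) (begin
      sum (map (λ e → deg E† (proj₁ e) * deg E† (proj₂ e)) E†)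
        ≡⟨ sum-dagger-degrees _*_ ⟩
      length E * ((k + k) * (k + k) + 2 * ((k + k) * 2) + 2 * 2)
        ≡⟨ arith (length E) k ⟩
      suc k * suc k * (4 * length E)
        ≡⟨ cong (suc k * suc k *_) (length-dagger E P pairing) ⟨
      suc k * suc k * length E†
        ∎)
    where
    arith : ∀ a k → a * ((k + k) * (k + k) + 2 * ((k + k) * 2) + 2 * 2) ≡ suc k * suc k * (4 * a)
    arith = solve-∀

  meanHalfSq-dagger : 1 ≤ length E → meanHalfSq E† ≡ (2 * (k * k + 1)) /1
  meanHalfSq-dagger m≥1 =
    /ₙ-exact (2 * (k * k + 1)) (2 * length E†) (double-length-dagger-positive E P pairing m≥1) (begin
      sum (map (λ e → deg E† (proj₁ e) * deg E† (proj₁ e) + deg E† (proj₂ e) * deg E† (proj₂ e)) E†)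
        ≡⟨ sum-dagger-degrees (λ x y → x * x + y * y) ⟩
      length E * (((k + k) * (k + k) + (k + k) * (k + k)) + 2 * ((k + k) * (k + k) + 2 * 2) + (2 * 2 + 2 * 2))
        ≡⟨ arith (length E) k ⟩
      2 * (k * k + 1) * (2 * (4 * length E))
        ≡⟨ cong (λ m → 2 * (k * k + 1) * (2 * m)) (length-dagger E P pairing) ⟨
      2 * (k * k + 1) * (2 * length E†)
        ∎)
    where
    arith : ∀ a k →
      a * (((k + k) * (k + k) + (k + k) * (k + k)) + 2 * ((k + k) * (k + k) + 2 * 2) + (2 * 2 + 2 * 2))
        ≡ 2 * (k * k + 1) * (2 * (4 * a))
    arith = solve-∀

  regular-dagger-neutral : 2 ≤ k → 1 ≤ length E → Neutral E†
  regular-dagger-neutral k≥2 m≥1 =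
    neutral-from-means E† (length-dagger-positive E P pairing m≥1) meanProd≡ meanHalfSq≢
    where
    meanHalfSum² : meanHalfSum E† ℚ.* meanHalfSum E† ≡ (suc k * suc k) /1
    meanHalfSum² = trans (cong₂ ℚ._*_ (meanHalfSum-dagger m≥1) (meanHalfSum-dagger m≥1))
                         (sym (/1-homo-* (suc k) (suc k)))

    meanProd≡ : meanProd E† ≡ meanHalfSum E† ℚ.* meanHalfSum E†
    meanProd≡ = trans (meanProd-dagger m≥1) (sym meanHalfSum²)

    meanHalfSq≢ : meanHalfSq E† ≢ meanHalfSum E† ℚ.* meanHalfSum E†
    meanHalfSq≢ eq =
      2[k²+1]≢[1+k]² k≥2 (/1-injective (trans (sym (meanHalfSq-dagger m≥1)) (trans eq meanHalfSum²)))

map-cycleEdges : ∀ {c} {C : Set c} {n} (f : Fin (suc n) × Fin (suc n) → C) →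
                 map f (cycleEdges (suc n)) ≡ tabulate (λ i → f (inject₁ i , suc i)) ∷ʳ f (fromℕ n , zero)
map-cycleEdges {C = C} {n} f = begin
  map f (map edge (allFin n) ∷ʳ (fromℕ n , zero))  ≡⟨ List.map-++ f (map edge (allFin n)) _ ⟩
  map f (map edge (allFin n)) ∷ʳ last               ≡⟨ cong (_∷ʳ last) (List.map-∘ (allFin n)) ⟨
  map (f ∘ edge) (allFin n) ∷ʳ last                 ≡⟨ cong (_∷ʳ last) (List.map-tabulate id (f ∘ edge)) ⟩
  tabulate (f ∘ edge) ∷ʳ last                       ∎
  where
  last : C
  last = f (fromℕ n , zero)

  edge : Fin n → Fin (suc n) × Fin (suc n)
  edge i = inject₁ i , suc i

cycle-heads : ∀ n → map proj₁ (cycleEdges n) ≡ allFin n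
cycle-heads zero    = refl
cycle-heads (suc n) = trans (map-cycleEdges proj₁) (sym (tabulate-∷ʳ id))

cycle-tails : ∀ n → map proj₂ (cycleEdges n) ↭ allFin n
cycle-tails zero    = ↭-refl
cycle-tails (suc n) = ↭-trans (↭-reflexive (map-cycleEdges proj₂)) (↭-sym (∷↭∷ʳ zero (tabulate suc)))

length-cycleEdges : ∀ n → length (cycleEdges n) ≡ n
length-cycleEdges n = begin
  length (cycleEdges n)              ≡⟨ List.length-map proj₁ (cycleEdges n) ⟨
  length (map proj₁ (cycleEdges n))  ≡⟨ cong length (cycle-heads n) ⟩
  length (allFin n)                  ≡⟨ List.length-tabulate id ⟩
  n                                  ∎

inject₁≢suc : ∀ {n} (i : Fin n) → inject₁ i ≢ suc i
inject₁≢suc zero    ()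
inject₁≢suc (suc i) = inject₁≢suc i ∘ suc-injective

cycle-loopless : ∀ {n} → 2 ≤ n → Loopless (cycleEdges n)
cycle-loopless {suc (suc n)} (s≤s (s≤s z≤n)) =
  All.++⁺ (All.map⁺ (All.universal inject₁≢suc (allFin (suc n)))) ((λ ()) ∷ [])

cycle-regular : ∀ {n} → 2 ≤ n → ∀ v → deg (cycleEdges n) v ≡ 2
cycle-regular {n} n≥2 v = begin
  deg (cycleEdges n) v
    ≡⟨ deg≡occurrences (cycle-loopless n≥2) v ⟩
  occurrences v (leafOwners (cycleEdges n))
    ≡⟨ occurrences-leafOwners (cycleEdges n) v ⟩
  occurrences v (map proj₁ (cycleEdges n)) + occurrences v (map proj₂ (cycleEdges n))
    ≡⟨ cong₂ _+_ (cong (occurrences v) (cycle-heads n)) (occurrences-↭ v (cycle-tails n)) ⟩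
  occurrences v (allFin n) + occurrences v (allFin n)
    ≡⟨ cong₂ _+_ (occurrences-allFin v) (occurrences-allFin v) ⟩
  2 ∎

lemma5 : (n : ℕ) → 3 ≤ n → (P : List (Leaf (cycleEdges n) × Leaf (cycleEdges n)))
         → IsPairing (cycleEdges n) P → Neutral (dagger (cycleEdges n) P)
lemma5 n n≥3 P pairing =
  regular-dagger-neutral (cycleEdges n) P (cycle-loopless n≥2) (cycle-regular n≥2) pairing ≤-refl m≥1
  where
  n≥2 : 2 ≤ n
  n≥2 = <⇒≤ n≥3
  m≥1 : 1 ≤ length (cycleEdges n)
  m≥1 = subst (1 ≤_) (sym (length-cycleEdges n)) (≤-trans (s≤s z≤n) n≥3)
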